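{- Let $n\ge 1$ and $a,b,c\in\mathbb{Z}_{2^n}$ with $p_2(a)=p_2(b)=0$ and $p_2(c)>0$. Then the equation $ax^2+bx+c\equiv 0 \pmod{2^n}$ has exactly two solutions $x\in\mathbb{Z}_{2^n}$.
   Context: $\mathbb{Z}_{2^n}$ denotes the ring of integers modulo $2^n$, elements represented by $0,\dots,2^n-1$. For nonzero $a\in\mathbb{Z}_{2^n}$, $p_2(a)$ is the exponent of the greatest power of $2$ dividing $a$; by convention $p_2(0)=n$. Thus $p_2(a)=0$ means $a$ is odd and $p_2(a)>0$ means $a$ is even. -}

module Defs where

open import Data.Nat using (ℕ; _+_; _*_; _^_; _<_)
open import Data.Nat.Divisibility using (_∣_)
open import Data.Product using (Σ; _×_)
open import Data.Sum using (_⊎_)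
open import Relation.Binary.PropositionalEquality using (_≡_)
open import Relation.Nullary using (¬_)

Z2^ : ℕ → Set
Z2^ n = Σ ℕ (λ x → x < 2 ^ n)

IsSol : (n a b c x : ℕ) → Set
IsSol n a b c x = 2 ^ n ∣ a * x * x + b * x + c

ExactlyTwoSolutions : (n a b c : ℕ) → Set
ExactlyTwoSolutions n a b c =
  Σ ℕ λ x → Σ ℕ λ y →
    (x < 2 ^ n) × (y < 2 ^ n) × ¬ (x ≡ y) × IsSol n a b c x × IsSol n a b c y ×
    ((z : ℕ) → z < 2 ^ n → IsSol n a b c z → (z ≡ x) ⊎ (z ≡ y))

module Submission where

-- Everything rests on
-- the identity
--     f(x + h) = f(x) + h · (a·(x + (x + h)) + b),
-- whose second factor (the "slope" between x and x + h) is odd as soon as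
-- x and x + h have the same parity, because b is odd.  Consequently:
--  * uniqueness: two roots modulo 2^n of the same parity differ by some h
--    with 2^n ∣ h · (odd number); the odd factor cancels (2 is prime), so
--    2^n ∣ h, and h = 0 when both roots lie in [0, 2^n);
--  * existence (Hensel lifting): if x is a root modulo 2^k with k ≥ 1, then x
--    or x + 2^k is a root modulo 2^(k+1), of the same parity as x.
-- Because a, b are odd and c is even, 0 and 1 are roots modulo 2.  Lifting
-- them gives an even and an odd root modulo 2^n, and uniqueness within each
-- parity class shows that there are no further roots.
-- The file develops parity, cancellation of odd factors, the shift identity,
-- uniqueness and lifting in that order, and derives lemma4 at the end.

open import Defs
open import Data.Nat using (ℕ; zero; suc; _+_; _*_; _^_; _<_; _≤_; z≤n; s≤s)
open import Data.Nat.Properties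
open import Data.Nat.Divisibility
open import Data.Nat.Primality using (prime[2]; euclidsLemma)
open import Data.Nat.Solver using (module +-*-Solver)
open import Data.Product using (Σ; _×_; _,_)
open import Data.Sum using (_⊎_; inj₁; inj₂)
open import Data.Empty using (⊥-elim)
open import Relation.Nullary using (¬_; yes; no)
open import Relation.Binary.PropositionalEquality
open +-*-Solver

-- Parity.  x and y have the same parity iff their sum is even; note that
-- SameParity 0 z is (definitionally) 2 ∣ z and SameParity 1 z is 2 ∣ suc z.
SameParity : ℕ → ℕ → Set
SameParity x y = 2 ∣ x + y

sameParity-refl : ∀ x → SameParity x x
sameParity-refl x = divides x (solve 1 (λ x → x :+ x := x :* con 2) refl x)

sameParity-sym : ∀ x y → SameParity x y → SameParity y x
sameParity-sym x y = subst (2 ∣_) (+-comm x y)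

sameParity-trans : ∀ x y z → SameParity x y → SameParity y z → SameParity x z
sameParity-trans x y z xy yz = ∣m+n∣m⇒∣n sum-even (n∣m*n y)
  where
  sum-even : 2 ∣ y * 2 + (x + z)
  sum-even = subst (2 ∣_)
    (solve 3 (λ x y z → (x :+ y) :+ (y :+ z) := y :* con 2 :+ (x :+ z)) refl x y z)
    (∣m∣n⇒∣m+n xy yz)

parity : ∀ z → SameParity 0 z ⊎ SameParity 1 z
parity zero = inj₁ (divides 0 refl)
parity (suc z) with parity z
... | inj₁ (divides q eq) = inj₂ (divides (suc q) (cong (λ w → suc (suc w)) eq))
... | inj₂ z+1-even       = inj₁ z+1-even

odd⇒sameParity-1 : ∀ {u} → ¬ 2 ∣ u → SameParity 1 u
odd⇒sameParity-1 {u} u-odd with parity u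
... | inj₁ u-even = ⊥-elim (u-odd u-even)
... | inj₂ u+1-even = u+1-even

odd+odd-even : ∀ u v → ¬ 2 ∣ u → ¬ 2 ∣ v → 2 ∣ u + v
odd+odd-even u v u-odd v-odd =
  sameParity-trans u 1 v (sameParity-sym 1 u (odd⇒sameParity-1 u-odd)) (odd⇒sameParity-1 v-odd)

cancel-odd : ∀ n {d u} → ¬ 2 ∣ u → 2 ^ n ∣ d * u → 2 ^ n ∣ d
cancel-odd zero    {d}     _     _ = 1∣ d
cancel-odd (suc n) {d} {u} u-odd h
  with euclidsLemma d u prime[2] (∣-trans (m∣m*n (2 ^ n)) h)
... | inj₂ u-even = ⊥-elim (u-odd u-even)
... | inj₁ (divides e refl) =
  subst (2 * 2 ^ n ∣_) (*-comm 2 e) (*-monoʳ-∣ 2 (cancel-odd n {e} u-odd halved))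
  where
  halved : 2 ^ n ∣ e * u
  halved = *-cancelˡ-∣ 2 (subst (2 * 2 ^ n ∣_)
    (solve 2 (λ e u → e :* con 2 :* u := con 2 :* (e :* u)) refl e u) h)

multiple-below : ∀ {m h} → m ∣ h → h < m → h ≡ 0
multiple-below {h = zero}  _ _  = refl
multiple-below {h = suc h} m∣h lt = ⊥-elim (<⇒≱ lt (∣⇒≤ m∣h))

f : ℕ → ℕ → ℕ → ℕ → ℕ
f a b c x = a * x * x + b * x + c

slope : ℕ → ℕ → ℕ → ℕ → ℕ
slope a b x y = a * (x + y) + b

shift : ∀ a b c x h → f a b c (x + h) ≡ f a b c x + h * slope a b x (x + h)
shift = solve 5 (λ a b c x h →
  a :* (x :+ h) :* (x :+ h) :+ b :* (x :+ h) :+ c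
    := (a :* x :* x :+ b :* x :+ c) :+ h :* (a :* (x :+ (x :+ h)) :+ b))
  refl

-- Between points of the same parity the slope is odd (only b matters).
slope-odd : ∀ a b x y → ¬ 2 ∣ b → SameParity x y → ¬ 2 ∣ slope a b x y
slope-odd a b x y b-odd xy slope-even = b-odd (∣m+n∣m⇒∣n slope-even (∣n⇒∣m*n a xy))

roots-same-parity-≤ : ∀ n a b c {x y} → ¬ 2 ∣ b → x ≤ y → SameParity x y → y < 2 ^ n →
                      IsSol n a b c x → IsSol n a b c y → x ≡ y
roots-same-parity-≤ n a b c {x} b-odd x≤y xy y< root-x root-y
  with m≤n⇒∃[o]m+o≡n x≤y
... | h , refl = sym (trans (cong (x +_) h≡0) (+-identityʳ x))
  where
  2^n∣h·slope : 2 ^ n ∣ h * slope a b x (x + h)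
  2^n∣h·slope = ∣m+n∣m⇒∣n (subst (2 ^ n ∣_) (shift a b c x h) root-y) root-x
  h≡0 : h ≡ 0
  h≡0 = multiple-below (cancel-odd n (slope-odd a b x (x + h) b-odd xy) 2^n∣h·slope)
                       (≤-<-trans (m≤n+m h x) y<)

roots-same-parity : ∀ n a b c {x y} → ¬ 2 ∣ b → SameParity x y → x < 2 ^ n → y < 2 ^ n →
                    IsSol n a b c x → IsSol n a b c y → x ≡ y
roots-same-parity n a b c {x} {y} b-odd xy x< y< root-x root-y with ≤-total x y
... | inj₁ x≤y = roots-same-parity-≤ n a b c b-odd x≤y xy y< root-x root-y
... | inj₂ y≤x = sym (roots-same-parity-≤ n a b c b-odd y≤x (sameParity-sym x y xy) x< root-y root-x)

Lift : ℕ → ℕ → ℕ → ℕ → ℕ → Set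
Lift k a b c x = Σ ℕ λ y → y < 2 ^ suc k × SameParity x y × IsSol (suc k) a b c y

-- Hensel step: a root x modulo P = 2^(suc k) lifts to x or x + P modulo 2P.
-- If f(x) = t·P with t odd then f(x + P) = (t + slope)·P with t + slope even.
lift-step : ∀ k a b c x → ¬ 2 ∣ b → x < 2 ^ suc k → IsSol (suc k) a b c x →
            Lift (suc k) a b c x
lift-step k a b c x b-odd x< (divides t f≡t·P) with 2 ^ suc (suc k) ∣? f a b c x
... | yes root′ = x , <-≤-trans x< (^-monoʳ-≤ 2 (n≤1+n (suc k))) , sameParity-refl x , root′
... | no not-root = x + P , bound , x~x+P , root′
  where
  P : ℕ
  P = 2 ^ suc k
  open ≡-Reasoning
  bound : x + P < 2 * P
  bound = subst (x + P <_) (cong (P +_) (sym (+-identityʳ P))) (+-monoˡ-< P x<)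
  x~x+P : SameParity x (x + P)
  x~x+P = subst (2 ∣_) (+-assoc x x P) (∣m∣n⇒∣m+n (sameParity-refl x) (m∣m*n (2 ^ k)))
  root′ : 2 * P ∣ f a b c (x + P)
  root′ = subst (2 * P ∣_) (sym f[x+P]≡) (*-monoˡ-∣ P (odd+odd-even t D t-odd D-odd))
    where
    D : ℕ
    D = slope a b x (x + P)
    t-odd : ¬ 2 ∣ t
    t-odd t-even = not-root (subst (2 * P ∣_) (sym f≡t·P) (*-monoˡ-∣ P t-even))
    D-odd : ¬ 2 ∣ D
    D-odd = slope-odd a b x (x + P) b-odd x~x+P
    f[x+P]≡ : f a b c (x + P) ≡ (t + D) * P
    f[x+P]≡ = begin
      f a b c (x + P)   ≡⟨ shift a b c x P ⟩
      f a b c x + P * D ≡⟨ cong (_+ P * D) f≡t·P ⟩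
      t * P + P * D     ≡⟨ cong (t * P +_) (*-comm P D) ⟩
      t * P + D * P     ≡⟨ *-distribʳ-+ P t D ⟨
      (t + D) * P       ∎

lift : ∀ m a b c x → ¬ 2 ∣ b → x < 2 → IsSol 1 a b c x → Lift m a b c x
lift zero    a b c x b-odd x<2 root = x , x<2 , sameParity-refl x , root
lift (suc m) a b c x b-odd x<2 root with lift m a b c x b-odd x<2 root
... | y , y< , x~y , root-y with lift-step m a b c y b-odd y< root-y
... | z , z< , y~z , root-z = z , z< , sameParity-trans x y z x~y y~z , root-z

zero-root : ∀ a b c → 2 ∣ c → IsSol 1 a b c 0
zero-root a b c c-even =
  subst (2 ∣_) (solve 3 (λ a b c → c := a :* con 0 :* con 0 :+ b :* con 0 :+ c) refl a b c) c-even

one-root : ∀ a b c → ¬ 2 ∣ a → ¬ 2 ∣ b → 2 ∣ c → IsSol 1 a b c 1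
one-root a b c a-odd b-odd c-even =
  subst (2 ∣_) (solve 3 (λ a b c → a :+ b :+ c := a :* con 1 :* con 1 :+ b :* con 1 :+ c) refl a b c)
        (∣m∣n⇒∣m+n (odd+odd-even a b a-odd b-odd) c-even)

lemma4 : (n a b c : ℕ) → 1 ≤ n → a < 2 ^ n → b < 2 ^ n → c < 2 ^ n →
    ¬ (2 ∣ a) → ¬ (2 ∣ b) → 2 ∣ c →
    ExactlyTwoSolutions n a b c
lemma4 (suc m) a b c _ _ _ _ a-odd b-odd c-even
  with lift m a b c 0 b-odd (s≤s z≤n) (zero-root a b c c-even)
     | lift m a b c 1 b-odd (s≤s (s≤s z≤n)) (one-root a b c a-odd b-odd c-even)
... | x₀ , x₀< , x₀-even , root₀ | x₁ , x₁< , x₁-odd , root₁ =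
  x₀ , x₁ , x₀< , x₁< , distinct , root₀ , root₁ , only-roots
  where
  distinct : ¬ x₀ ≡ x₁
  distinct refl with ∣1⇒≡1 (sameParity-trans 0 x₀ 1 x₀-even (sameParity-sym 1 x₀ x₁-odd))
  ... | ()
  only-roots : (z : ℕ) → z < 2 ^ suc m → IsSol (suc m) a b c z → (z ≡ x₀) ⊎ (z ≡ x₁)
  only-roots z z< root with parity z
  ... | inj₁ z-even = inj₁ (roots-same-parity (suc m) a b c b-odd
                              (sameParity-trans z 0 x₀ (sameParity-sym 0 z z-even) x₀-even) z< x₀< root root₀)
  ... | inj₂ z-odd  = inj₂ (roots-same-parity (suc m) a b c b-odd
                              (sameParity-trans z 1 x₁ (sameParity-sym 1 z z-odd) x₁-odd) z< x₁< root root₁)
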